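{- Let $\mathcal{S}=(Q,\mathcal{B})$ be a nested SQS$(v)$ and let $\{F_1,\dots,F_{v-1}\}$ be a one-factorization of the complete graph $K_v$ on vertex set $Q$. Let $\mathcal{D}$ be the nested SQS$(2v)$ on $Q\times\{0,1\}$ whose blocks are: (Type I) $\{(x,i),(y,i),(z,i),(w,i)\}$ for $\{x,y,z,w\}\in\mathcal{B}$, $i\in\{0,1\}$, partitioned into $\{(x,i),(y,i)\}$ and $\{(z,i),(w,i)\}$ exactly when $\{x,y,z,w\}$ is partitioned into $\{x,y\}$ and $\{z,w\}$ in $\mathcal{S}$; and (Type II) $\{(x,0),(y,0),(z,1),(w,1)\}$ for $\{x,y\}\in F_i$, $\{z,w\}\in F_i$ (not necessarily distinct edges), $1\le i\le v-1$, partitioned into $\{(x,0),(y,0)\}$ and $\{(z,1),(w,1)\}$. Then $\mathcal{D}$ has exactly $v(v-1)$ ND-pairs, and each element of $Q\times\{0,1\}$ is contained in exactly $v-1$ ND-pairs.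
   Context: A Steiner quadruple system SQS$(v)$ is a pair $(Q,\mathcal{B})$ where $Q$ is a set of $v$ points and $\mathcal{B}$ is a collection of 4-subsets of $Q$ (blocks) such that every 3-subset of $Q$ is contained in exactly one block. A nested SQS$(v)$ is an SQS$(v)$ together with a partition of each block into two 2-subsets (pairs). A pair of points is an ND-pair if it is one of the two pairs in the partition of at least one block; the multiplicity of a pair is the number of blocks whose partition contains that pair. A one-factorization of $K_v$ ($v$ even) is a partition of its edge set into $v-1$ perfect matchings. (The block set described is a known doubling construction of an SQS$(2v)$.) -}

module Defs where

open import Data.Nat using (ℕ; suc; _∸_)
open import Data.Fin using (Fin) renaming (_≟_ to _≟ᶠ_)
open import Data.Bool using (Bool; true; false; _∧_; _∨_; not; if_then_else_)
open import Data.Bool.Properties using () renaming (_≟_ to _≟ᵇ_)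
open import Data.List using (List; []; _∷_; map; concatMap; _++_; cartesianProduct; allFin)
open import Data.Bool.ListAction using (any)
open import Data.Nat.ListAction using (sum)
open import Data.List.Membership.Propositional using (_∈_)
open import Data.Product using (_×_; _,_; proj₁; proj₂)
open import Data.Product.Properties using (≡-dec)
open import Relation.Binary.Definitions using (DecidableEquality)
open import Relation.Binary.PropositionalEquality using (_≡_; _≢_)
open import Relation.Nullary.Decidable using (⌊_⌋)

count : {A : Set} → (A → Bool) → List A → ℕ
count p [] = 0
count p (x ∷ xs) = if p x then suc (count p xs) else count p xs

-- A pair {a,b} is represented by an ordered pair (a , b), compared up to order.
-- A nested block ((a , b) , (c , d)) is the block {a,b,c,d} partitioned
-- into the two pairs {a,b} and {c,d}.
NBlock : Set → Set
NBlock A = (A × A) × (A × A)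

module _ {A : Set} (_≟_ : DecidableEquality A) where

  eqb : A → A → Bool
  eqb x y = ⌊ x ≟ y ⌋

  samePair : A × A → A × A → Bool
  samePair (a , b) (c , d) = (eqb a c ∧ eqb b d) ∨ (eqb a d ∧ eqb b c)

  blockPoints : NBlock A → List A
  blockPoints ((a , b) , (c , d)) = a ∷ b ∷ c ∷ d ∷ []

  inBlock : A → NBlock A → Bool
  inBlock x blk = any (eqb x) (blockPoints blk)

  containsTriple : A → A → A → NBlock A → Bool
  containsTriple x y z blk = inBlock x blk ∧ inBlock y blk ∧ inBlock z blk

  hasPair : A × A → NBlock A → Bool
  hasPair p (P₁ , P₂) = samePair p P₁ ∨ samePair p P₂

  isND : List (NBlock A) → A × A → Bool
  isND D p = any (hasPair p) D

Distinct4 : {A : Set} → NBlock A → Set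
Distinct4 ((a , b) , (c , d)) =
  a ≢ b × a ≢ c × a ≢ d × b ≢ c × b ≢ d × c ≢ d

IsNestedSQS : (v : ℕ) → List (NBlock (Fin v)) → Set
IsNestedSQS v B =
  (∀ blk → blk ∈ B → Distinct4 blk) ×
  (∀ x y z → x ≢ y → x ≢ z → y ≢ z → count (containsTriple _≟ᶠ_ x y z) B ≡ 1)

IsOneFactorization : (v : ℕ) → (Fin (v ∸ 1) → List (Fin v × Fin v)) → Set
IsOneFactorization v F =
  (∀ i e → e ∈ F i → proj₁ e ≢ proj₂ e) ×
  (∀ i x → count (λ e → eqb _≟ᶠ_ x (proj₁ e) ∨ eqb _≟ᶠ_ x (proj₂ e)) (F i) ≡ 1) ×
  (∀ x y → x ≢ y →
     sum (map (λ i → count (samePair _≟ᶠ_ (x , y)) (F i)) (allFin (v ∸ 1))) ≡ 1)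

-- points of the doubled design: Q × {0,1}, with 0 = false, 1 = true
Pt : ℕ → Set
Pt v = Fin v × Bool

_≟ₚ_ : {v : ℕ} → DecidableEquality (Pt v)
_≟ₚ_ = ≡-dec _≟ᶠ_ _≟ᵇ_

allPoints : (v : ℕ) → List (Pt v)
allPoints v = cartesianProduct (allFin v) (false ∷ true ∷ [])

-- all 2-subsets of a (duplicate-free) list, each listed once
pairsOf : {A : Set} → List A → List (A × A)
pairsOf [] = []
pairsOf (x ∷ xs) = map (x ,_) xs ++ pairsOf xs

liftBlock : {v : ℕ} → Bool → NBlock (Fin v) → NBlock (Pt v)
liftBlock i ((x , y) , (z , w)) = (((x , i) , (y , i)) , ((z , i) , (w , i)))

typeI : (v : ℕ) → List (NBlock (Fin v)) → List (NBlock (Pt v))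
typeI v B = concatMap (λ i → map (liftBlock i) B) (false ∷ true ∷ [])

typeII : (v : ℕ) → (Fin (v ∸ 1) → List (Fin v × Fin v)) → List (NBlock (Pt v))
typeII v F =
  concatMap (λ i →
    concatMap (λ e →
      map (λ e' → (((proj₁ e , false) , (proj₂ e , false)) ,
                   ((proj₁ e' , true) , (proj₂ e' , true))))
          (F i))
      (F i))
    (allFin (v ∸ 1))

doubled : (v : ℕ) → List (NBlock (Fin v)) → (Fin (v ∸ 1) → List (Fin v × Fin v))
        → List (NBlock (Pt v))
doubled v B F = typeI v B ++ typeII v F

{-# OPTIONS --safe #-}
-- Every pair of a block of D lies within one level Q × {i}. Conversely, if
-- x ≠ y then the edge {x,y} lies in some factor F_k, and the Type II block
-- built from that edge taken twice contains {(x,i),(y,i)} as one of its pairs.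
-- So the ND-pairs of D are exactly the 2-subsets of the two levels, giving
-- 2·C(v,2) = v(v−1) of them and v − 1 through each point.
module Submission where

open import Defs
open import Algebra.Properties.CommutativeSemigroup as CommSemigroupProperties using ()
open import Data.Bool using (Bool; true; false; T; not; _∧_)
open import Data.Bool.Properties using (T-∨; T-∧; T-≡) renaming (_≟_ to _≟ᵇ_)
open import Data.Empty using (⊥-elim)
open import Data.Fin using (Fin) renaming (_≟_ to _≟ᶠ_)
open import Data.List using (List; []; _∷_; map; concatMap; _++_; length; allFin; cartesianProduct)
open import Data.List.Properties using (length-tabulate)
open import Data.List.Membership.Propositional using (_∈_; lose; find)
open import Data.List.Membership.Propositional.Properties
  using (∈-++⁺ʳ; ∈-concatMap⁺; ∈-map⁺; ∈-allFin; ∈-cartesianProduct⁺)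
open import Data.List.Relation.Unary.All as All using (All; []; _∷_)
import Data.List.Relation.Unary.All.Properties as All
open import Data.List.Relation.Unary.Any using (Any; here; there; satisfied)
open import Data.List.Relation.Unary.Any.Properties using (any⁺; any⁻)
open import Data.List.Relation.Unary.AllPairs using (AllPairs; []; _∷_)
open import Data.List.Relation.Unary.Unique.Propositional using (Unique)
open import Data.List.Relation.Unary.Unique.Propositional.Properties using (cartesianProduct⁺; allFin⁺)
open import Data.Nat using (ℕ; zero; suc; _+_; _*_; _∸_; _<_; z<s)
open import Data.Nat.Combinatorics using (_C_; nC1≡n; nCk+nC[k+1]≡[n+1]C[k+1])
open import Data.Nat.ListAction using (sum)
open import Data.Nat.Properties using (+-assoc; *-suc; ≤-reflexive; +-commutativeSemigroup)
open import Data.Product using (_×_; _,_; proj₂; ∃₂; uncurry; curry)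
open import Data.Sum using (_⊎_; inj₁; inj₂)
import Data.Sum as Sum
import Data.Product as Product
open import Function using (id; _∘_; _on_; _⇔_; mk⇔; Equivalence)
open import Relation.Binary.Definitions using (DecidableEquality; Symmetric)
open import Relation.Binary.PropositionalEquality
  using (_≡_; _≢_; refl; sym; trans; cong; cong₂; subst; ≢-sym; module ≡-Reasoning)
open import Relation.Nullary.Decidable using (yes; no; toWitness; fromWitness; dec-false; isYes≗does)

open CommSemigroupProperties +-commutativeSemigroup using (interchange; x∙yz≈y∙xz)
open ≡-Reasoning

private variable A B : Set

T-injective : ∀ {x y} → T x ⇔ T y → x ≡ y
T-injective {false} {false} _ = refl
T-injective {false} {true}  x⇔y = ⊥-elim (Equivalence.from x⇔y _)
T-injective {true}  {false} x⇔y = ⊥-elim (Equivalence.to x⇔y _)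
T-injective {true}  {true}  _ = refl

eqb-≢ : (_≟_ : DecidableEquality A) {x y : A} → x ≢ y → eqb _≟_ x y ≡ false
eqb-≢ _≟_ {x} {y} x≢y = trans (isYes≗does (x ≟ y)) (dec-false (x ≟ y) x≢y)

suc-C2 : ∀ n → suc n C 2 ≡ n + n C 2
suc-C2 n = trans (sym (nCk+nC[k+1]≡[n+1]C[k+1] n 1)) (cong (_+ n C 2) (nC1≡n n))

n+n*[n∸1]≡n*n : ∀ n → n + n * (n ∸ 1) ≡ n * n
n+n*[n∸1]≡n*n zero    = refl
n+n*[n∸1]≡n*n (suc n) = sym (*-suc (suc n) n)

nC2+nC2≡n*[n∸1] : ∀ n → n C 2 + n C 2 ≡ n * (n ∸ 1)
nC2+nC2≡n*[n∸1] zero    = refl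
nC2+nC2≡n*[n∸1] (suc n) = begin
  suc n C 2 + suc n C 2       ≡⟨ cong₂ _+_ (suc-C2 n) (suc-C2 n) ⟩
  (n + n C 2) + (n + n C 2)   ≡⟨ interchange n (n C 2) n (n C 2) ⟩
  (n + n) + (n C 2 + n C 2)   ≡⟨ cong ((n + n) +_) (nC2+nC2≡n*[n∸1] n) ⟩
  (n + n) + n * (n ∸ 1)       ≡⟨ +-assoc n n _ ⟩
  n + (n + n * (n ∸ 1))       ≡⟨ cong (n +_) (n+n*[n∸1]≡n*n n) ⟩
  n + n * n                   ∎

0<sum⇒Any : ∀ (f : A → ℕ) xs → 0 < sum (map f xs) → Any ((0 <_) ∘ f) xs
0<sum⇒Any f (x ∷ xs) pos with f x in fx
... | zero  = there (0<sum⇒Any f xs pos)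
... | suc _ = here (subst (0 <_) (sym fx) z<s)

count-++ : ∀ (f : A → Bool) xs ys → count f (xs ++ ys) ≡ count f xs + count f ys
count-++ f []       ys = refl
count-++ f (x ∷ xs) ys with f x
... | true  = cong suc (count-++ f xs ys)
... | false = count-++ f xs ys

count-map : ∀ (f : B → Bool) (g : A → B) xs → count f (map g xs) ≡ count (f ∘ g) xs
count-map f g []       = refl
count-map f g (x ∷ xs) with f (g x)
... | true  = cong suc (count-map f g xs)
... | false = count-map f g xs

count-cong : ∀ {f g : A → Bool} {xs} → All (λ x → f x ≡ g x) xs → count f xs ≡ count g xs
count-cong [] = refl
count-cong {g = g} {x ∷ _} (fx≡gx ∷ f≗g) rewrite fx≡gx with g x
... | true  = cong suc (count-cong f≗g)
... | false = count-cong f≗g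

0<count⇒Any : ∀ (f : A → Bool) xs → 0 < count f xs → Any (T ∘ f) xs
0<count⇒Any f (x ∷ xs) pos with f x in fx
... | true  = here (Equivalence.from T-≡ fx)
... | false = there (0<count⇒Any f xs pos)

count-punctured : (_≟_ : DecidableEquality A) {f : A → Bool} {x : A} {xs : List A} →
                  Unique xs → x ∈ xs → T (f x) →
                  suc (count (λ y → not (eqb _≟_ x y) ∧ f y) xs) ≡ count f xs
count-punctured _≟_ {f} {x} (x∉ys ∷ _) (here refl) fx
  with x ≟ x | f x
... | no x≢x | _     = ⊥-elim (x≢x refl)
... | yes _  | false = ⊥-elim fx
... | yes _  | true  =
  cong suc (count-cong (All.map (λ {y} x≢y → cong (λ b → not b ∧ f y) (eqb-≢ _≟_ x≢y)) x∉ys))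
count-punctured _≟_ {f} {x} {y ∷ _} (y∉ys ∷ u) (there x∈ys) fx
  rewrite eqb-≢ _≟_ (≢-sym (All.lookup y∉ys x∈ys)) with f y
... | true  = cong suc (count-punctured _≟_ u x∈ys fx)
... | false = count-punctured _≟_ u x∈ys fx

pairsOf⁺ : ∀ {R : A → A → Set} {xs} → AllPairs R xs → All (uncurry R) (pairsOf xs)
pairsOf⁺ []            = []
pairsOf⁺ (x∼xs ∷ ∼xs) = All.++⁺ (All.map⁺ x∼xs) (pairsOf⁺ ∼xs)

All-concatMap⁺ : ∀ {P : B → Set} (f : A → List B) xs → (∀ x → All P (f x)) → All P (concatMap f xs)
All-concatMap⁺ f xs Pf = All.concat⁺ (All.map⁺ (All.universal Pf xs))

count-pairsOf-∷ : ∀ (f : A × A → Bool) x xs →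
                  count f (pairsOf (x ∷ xs)) ≡ count (curry f x) xs + count f (pairsOf xs)
count-pairsOf-∷ f x xs =
  trans (count-++ f (map (x ,_) xs) (pairsOf xs)) (cong (_+ _) (count-map f (x ,_) xs))

count-pairsOf-sameColour : ∀ (c : A → Bool) xs →
  count (uncurry (eqb _≟ᵇ_ on c)) (pairsOf xs)
    ≡ count (eqb _≟ᵇ_ false ∘ c) xs C 2 + count (eqb _≟ᵇ_ true ∘ c) xs C 2
count-pairsOf-sameColour c []       = refl
count-pairsOf-sameColour c (x ∷ xs) = begin
  count (uncurry (eqb _≟ᵇ_ on c)) (pairsOf (x ∷ xs))
    ≡⟨ count-pairsOf-∷ (uncurry (eqb _≟ᵇ_ on c)) x xs ⟩
  count (eqb _≟ᵇ_ (c x) ∘ c) xs + count (uncurry (eqb _≟ᵇ_ on c)) (pairsOf xs)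
    ≡⟨ cong (count (eqb _≟ᵇ_ (c x) ∘ c) xs +_) (count-pairsOf-sameColour c xs) ⟩
  count (eqb _≟ᵇ_ (c x) ∘ c) xs + (n false C 2 + n true C 2)
    ≡⟨ joinClass ⟩
  count (eqb _≟ᵇ_ false ∘ c) (x ∷ xs) C 2 + count (eqb _≟ᵇ_ true ∘ c) (x ∷ xs) C 2 ∎
  where
    n : Bool → ℕ
    n b = count (eqb _≟ᵇ_ b ∘ c) xs
    joinClass : count (eqb _≟ᵇ_ (c x) ∘ c) xs + (n false C 2 + n true C 2)
          ≡ count (eqb _≟ᵇ_ false ∘ c) (x ∷ xs) C 2 + count (eqb _≟ᵇ_ true ∘ c) (x ∷ xs) C 2
    joinClass with c x
    ... | false = trans (sym (+-assoc (n false) (n false C 2) (n true C 2)))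
                        (cong (_+ n true C 2) (sym (suc-C2 (n false))))
    ... | true  = trans (x∙yz≈y∙xz (n true) (n false C 2) (n true C 2))
                        (cong (n false C 2 +_) (sym (suc-C2 (n true))))

EachPair : (A → A → Set) → NBlock A → Set
EachPair _∼_ ((a , b) , (c , d)) = a ∼ b × c ∼ d

module _ (_≟_ : DecidableEquality A) {a b c d : A} where

  samePair-sound : T (samePair _≟_ (a , b) (c , d)) → (a ≡ c × b ≡ d) ⊎ (a ≡ d × b ≡ c)
  samePair-sound h = Sum.map both both (Equivalence.to T-∨ h)
    where
      both : ∀ {w x y z} → T (eqb _≟_ w x ∧ eqb _≟_ y z) → w ≡ x × y ≡ z
      both {w} {x} {y} {z} h with w≡x , y≡z ← Equivalence.to (T-∧ {eqb _≟_ w x}) h =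
        toWitness {a? = w ≟ x} w≡x , toWitness {a? = y ≟ z} y≡z

  samePair-complete : (a ≡ c × b ≡ d) ⊎ (a ≡ d × b ≡ c) → T (samePair _≟_ (a , b) (c , d))
  samePair-complete h = Equivalence.from T-∨ (Sum.map both both h)
    where
      both : ∀ {w x y z} → w ≡ x × y ≡ z → T (eqb _≟_ w x ∧ eqb _≟_ y z)
      both {w} {x} {y} {z} (w≡x , y≡z) =
        Equivalence.from (T-∧ {eqb _≟_ w x}) (fromWitness {a? = w ≟ x} w≡x , fromWitness {a? = y ≟ z} y≡z)

samePair-map : (_≟ᴬ_ : DecidableEquality A) (_≟ᴮ_ : DecidableEquality B) (f : A → B) {a b c d : A} →
               T (samePair _≟ᴬ_ (a , b) (c , d)) → T (samePair _≟ᴮ_ (f a , f b) (f c , f d))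
samePair-map _≟ᴬ_ _≟ᴮ_ f h = samePair-complete _≟ᴮ_ (Sum.map cong-f cong-f (samePair-sound _≟ᴬ_ h))
  where
    cong-f : ∀ {w x y z} → w ≡ x × y ≡ z → f w ≡ f x × f y ≡ f z
    cong-f (w≡x , y≡z) = cong f w≡x , cong f y≡z

module _ (_≟_ : DecidableEquality A) {_∼_ : A → A → Set} (∼-sym : Symmetric _∼_) where

  samePair-respects : ∀ {p q a b} → a ∼ b → T (samePair _≟_ (p , q) (a , b)) → p ∼ q
  samePair-respects a∼b h with samePair-sound _≟_ h
  ... | inj₁ (refl , refl) = a∼b
  ... | inj₂ (refl , refl) = ∼-sym a∼b

  hasPair-respects : ∀ {p q} blk → EachPair _∼_ blk → T (hasPair _≟_ (p , q) blk) → p ∼ q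
  hasPair-respects ((a , b) , (c , d)) (a∼b , c∼d) h with Equivalence.to T-∨ h
  ... | inj₁ pq≈ab = samePair-respects a∼b pq≈ab
  ... | inj₂ pq≈cd = samePair-respects c∼d pq≈cd

  isND-respects : ∀ {p q} D → All (EachPair _∼_) D → T (isND _≟_ D (p , q)) → p ∼ q
  isND-respects D D∼ h with blk , blk∈D , h′ ← find (any⁻ _ D h) =
    hasPair-respects blk (All.lookup D∼ blk∈D) h′

IsOneFactorization⇒covers : ∀ {v} {F : Fin (v ∸ 1) → List (Fin v × Fin v)} →
  IsOneFactorization v F → ∀ {x y} → x ≢ y → ∃₂ λ k e → e ∈ F k × T (samePair _≟ᶠ_ (x , y) e)
IsOneFactorization⇒covers {v} {F} (_ , _ , coveredOnce) {x} {y} x≢y =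
  let k , xy∈Fk = satisfied (0<sum⇒Any (λ k → count (samePair _≟ᶠ_ (x , y)) (F k)) (allFin (v ∸ 1))
                                        (≤-reflexive (sym (coveredOnce x y x≢y))))
      e , e∈Fk , xy≈e = find (0<count⇒Any (samePair _≟ᶠ_ (x , y)) (F k) xy∈Fk)
  in k , e , e∈Fk , xy≈e

sameLevel : ∀ {v} → Pt v → Pt v → Bool
sameLevel = eqb _≟ᵇ_ on proj₂

atLevel : ∀ {v} → Bool → Fin v × Fin v → Pt v × Pt v
atLevel i (x , y) = (x , i) , (y , i)

crossBlock : ∀ {v} → Fin v × Fin v → NBlock (Pt v)
crossBlock e = atLevel false e , atLevel true e

crossBlock∈typeII : ∀ {v F k e} → e ∈ F k → crossBlock e ∈ typeII v F
crossBlock∈typeII {k = k} e∈Fk =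
  ∈-concatMap⁺ _ (lose (∈-allFin k) (∈-concatMap⁺ _ (lose e∈Fk (∈-map⁺ _ e∈Fk))))

hasPair-crossBlock : ∀ {v} {a b : Fin v} i e → T (samePair _≟ᶠ_ (a , b) e) →
                     T (hasPair _≟ₚ_ (atLevel i (a , b)) (crossBlock e))
hasPair-crossBlock {a = a} {b} false (c , d) ab≈cd =
  Equivalence.from (T-∨ {samePair _≟ₚ_ (atLevel false (a , b)) (atLevel false (c , d))})
                   (inj₁ (samePair-map _≟ᶠ_ _≟ₚ_ (_, false) {a} {b} {c} {d} ab≈cd))
hasPair-crossBlock {a = a} {b} true (c , d) ab≈cd =
  Equivalence.from (T-∨ {samePair _≟ₚ_ (atLevel true (a , b)) (atLevel false (c , d))})
                   (inj₂ (samePair-map _≟ᶠ_ _≟ₚ_ (_, true) {a} {b} {c} {d} ab≈cd))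

doubled-levelled : ∀ v B F → All (EachPair (_≡_ on proj₂)) (doubled v B F)
doubled-levelled v B F = All.++⁺ typeI-levelled typeII-levelled
  where
    typeI-levelled : All (EachPair (_≡_ on proj₂)) (typeI v B)
    typeI-levelled = All-concatMap⁺ (λ i → map (liftBlock i) B) (false ∷ true ∷ [])
      (λ _ → All.map⁺ (All.universal (λ _ → refl , refl) B))
    typeII-levelled : All (EachPair (_≡_ on proj₂)) (typeII v F)
    typeII-levelled =
      All-concatMap⁺ _ (allFin (v ∸ 1)) (λ k → All-concatMap⁺ _ (F k)
        (λ _ → All.map⁺ (All.universal (λ _ → refl , refl) (F k))))

isND-doubled-complete : ∀ {v} B F → IsOneFactorization v F → ∀ {a b : Fin v} → a ≢ b →
                        ∀ i → T (isND _≟ₚ_ (doubled v B F) (atLevel i (a , b)))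
isND-doubled-complete {v} B F OF {a} {b} a≢b i
  with k , e , e∈Fk , ab≈e ← IsOneFactorization⇒covers OF a≢b =
  any⁺ _ (lose (∈-++⁺ʳ (typeI v B) (crossBlock∈typeII {F = F} {k} e∈Fk))
               (hasPair-crossBlock {a = a} {b} i e ab≈e))

isND-doubled : ∀ {v} B F → IsOneFactorization v F → ∀ {p q : Pt v} → p ≢ q →
               isND _≟ₚ_ (doubled v B F) (p , q) ≡ sameLevel p q
isND-doubled {v} B F OF {a , i} {b , j} p≢q = T-injective (mk⇔ sound complete)
  where
    sound : T (isND _≟ₚ_ (doubled v B F) ((a , i) , (b , j))) → T (sameLevel (a , i) (b , j))
    sound = fromWitness ∘ isND-respects _≟ₚ_ sym {a , i} {b , j} _ (doubled-levelled v B F)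
    complete : T (sameLevel (a , i) (b , j)) → T (isND _≟ₚ_ (doubled v B F) ((a , i) , (b , j)))
    complete h with refl ← toWitness {a? = i ≟ᵇ j} h =
      isND-doubled-complete B F OF {a} {b} (p≢q ∘ cong (_, i)) i

count-level-cartesianProduct : ∀ i (xs : List A) →
  count (eqb _≟ᵇ_ i ∘ proj₂) (cartesianProduct xs (false ∷ true ∷ [])) ≡ length xs
count-level-cartesianProduct false []       = refl
count-level-cartesianProduct false (_ ∷ xs) = cong suc (count-level-cartesianProduct false xs)
count-level-cartesianProduct true  []       = refl
count-level-cartesianProduct true  (_ ∷ xs) = cong suc (count-level-cartesianProduct true xs)

count-level-allPoints : ∀ v i → count (eqb _≟ᵇ_ i ∘ proj₂) (allPoints v) ≡ v
count-level-allPoints v i = trans (count-level-cartesianProduct i (allFin v)) (length-tabulate id)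

allPoints-unique : ∀ v → Unique (allPoints v)
allPoints-unique v = cartesianProduct⁺ (allFin⁺ v) (((λ ()) ∷ []) ∷ [] ∷ [])

∈-allPoints : ∀ {v} (p : Pt v) → p ∈ allPoints v
∈-allPoints (x , false) = ∈-cartesianProduct⁺ (∈-allFin x) (here refl)
∈-allPoints (x , true)  = ∈-cartesianProduct⁺ (∈-allFin x) (there (here refl))

lemma3p2 : (v : ℕ) (B : List (NBlock (Fin v))) (F : Fin (v ∸ 1) → List (Fin v × Fin v))
    → IsNestedSQS v B → IsOneFactorization v F
    → count (isND _≟ₚ_ (doubled v B F)) (pairsOf (allPoints v)) ≡ v * (v ∸ 1)
      × (∀ (p : Pt v) → count (λ q → not (eqb _≟ₚ_ p q) ∧ isND _≟ₚ_ (doubled v B F) (p , q)) (allPoints v) ≡ v ∸ 1)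
lemma3p2 v B F _ OF = ndPairs , degree
  where
    D = doubled v B F

    ndPairs : count (isND _≟ₚ_ D) (pairsOf (allPoints v)) ≡ v * (v ∸ 1)
    ndPairs = begin
      count (isND _≟ₚ_ D) (pairsOf (allPoints v))
        ≡⟨ count-cong (All.map (isND-doubled B F OF) (pairsOf⁺ (allPoints-unique v))) ⟩
      count (uncurry sameLevel) (pairsOf (allPoints v))
        ≡⟨ count-pairsOf-sameColour proj₂ (allPoints v) ⟩
      count (eqb _≟ᵇ_ false ∘ proj₂) (allPoints v) C 2 + count (eqb _≟ᵇ_ true ∘ proj₂) (allPoints v) C 2
        ≡⟨ cong₂ (λ m n → m C 2 + n C 2) (count-level-allPoints v false) (count-level-allPoints v true) ⟩
      v C 2 + v C 2
        ≡⟨ nC2+nC2≡n*[n∸1] v ⟩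
      v * (v ∸ 1) ∎

    degree : ∀ p → count (λ q → not (eqb _≟ₚ_ p q) ∧ isND _≟ₚ_ D (p , q)) (allPoints v) ≡ v ∸ 1
    degree p = begin
      count (λ q → not (eqb _≟ₚ_ p q) ∧ isND _≟ₚ_ D (p , q)) (allPoints v)
        ≡⟨ count-cong (All.universal offDiagonal (allPoints v)) ⟩
      count (λ q → not (eqb _≟ₚ_ p q) ∧ sameLevel p q) (allPoints v)
        ≡⟨ cong (_∸ 1) (count-punctured _≟ₚ_ (allPoints-unique v) (∈-allPoints p) (fromWitness refl)) ⟩
      count (sameLevel p) (allPoints v) ∸ 1
        ≡⟨ cong (_∸ 1) (count-level-allPoints v (proj₂ p)) ⟩
      v ∸ 1 ∎
      where
        offDiagonal : ∀ q → not (eqb _≟ₚ_ p q) ∧ isND _≟ₚ_ D (p , q) ≡ not (eqb _≟ₚ_ p q) ∧ sameLevel p q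
        offDiagonal q with p ≟ₚ q
        ... | yes _   = refl
        ... | no p≢q = isND-doubled B F OF p≢q
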